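{- There is a function $f:\mathbb{N}\to\mathbb{R}$ with $f(n)/\sqrt{n}\to 0$ as $n\to\infty$ such that the following holds. Let $(X,+)$ be a finite abelian group and let $\mathcal{A}\subseteq X$ be a Sidon set with zero deficiency, i.e. $\mathcal{A}-\mathcal{A}=X$; write $|\mathcal{A}|=\sqrt{|X|}-\delta$. If $H$ is a graph obtained from the sum graph $G_{X,\mathcal{A}}$ by adding one edge joining two distinct nonadjacent vertices, then $H$ contains at least $\sqrt{|X|}+f(|X|)$ copies of $C_4$ (i.e. at least $\sqrt{|X|}+o(\sqrt{|X|})$ copies, as $|X|\to\infty$).
   Context: A nonempty subset $\mathcal{A}$ of an abelian group $(X,+)$ is a Sidon set if $a+b=c+d$ with $a,b,c,d\in\mathcal{A}$ implies $\{a,b\}=\{c,d\}$. The difference set is $\mathcal{A}-\mathcal{A}=\{a-b: a,b\in\mathcal{A}\}$ and the deficiency of $\mathcal{A}$ is $d(\mathcal{A})=|X|-|\mathcal{A}-\mathcal{A}|$. The sum graph $G_{X,\mathcal{A}}$ has vertex set $X$, and distinct $x,y\in X$ are adjacent iff $x+y\in\mathcal{A}$. A copy of $C_4$ is a subgraph isomorphic to the cycle of length 4. -}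

module Defs where

open import Data.Nat using (ℕ; _/_)
open import Data.Fin using (Fin; _≟_)
open import Data.Fin.Subset using (Subset; _∈_)
open import Data.Fin.Subset.Properties using (_∈?_)
open import Data.List using (List; map; allFin)
open import Data.Nat.ListAction using (sum)
open import Data.Product using (_×_; ∃-syntax)
open import Data.Sum using (_⊎_; inj₁; inj₂)
open import Relation.Nullary using (Dec; yes; no; ¬_; does)
open import Relation.Nullary.Decidable using (_×-dec_; _⊎-dec_; ¬?)
open import Relation.Binary.PropositionalEquality using (_≡_; _≢_)
open import Algebra.Core using (Op₁; Op₂)
open import Algebra.Structures using (IsAbelianGroup)
open import Data.Bool using (if_then_else_)

-- A finite abelian group, presented (up to isomorphism) on the carrier Fin n,
-- with propositional equality as the group's equality.
record FinAbGroup : Set where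
  field
    n      : ℕ
    _+_    : Op₂ (Fin n)
    0#     : Fin n
    -_     : Op₁ (Fin n)
    isAbelianGroup : IsAbelianGroup _≡_ _+_ 0# -_

module _ (G : FinAbGroup) where
  open FinAbGroup G

  IsSidon : Subset n → Set
  IsSidon A = ∀ {a b c d} → a ∈ A → b ∈ A → c ∈ A → d ∈ A →
              a + b ≡ c + d → (a ≡ c × b ≡ d) ⊎ (a ≡ d × b ≡ c)

  ZeroDeficiency : Subset n → Set
  ZeroDeficiency A = ∀ x → ∃[ a ] ∃[ b ] (a ∈ A × b ∈ A × x ≡ a + (- b))

  SumAdj : Subset n → Fin n → Fin n → Set
  SumAdj A x y = x ≢ y × (x + y) ∈ A

  sumAdj? : ∀ A x y → Dec (SumAdj A x y)
  sumAdj? A x y = ¬? (x ≟ y) ×-dec ((x + y) ∈? A)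

  HAdj : Subset n → Fin n → Fin n → Fin n → Fin n → Set
  HAdj A u v x y = SumAdj A x y ⊎ ((x ≡ u × y ≡ v) ⊎ (x ≡ v × y ≡ u))

  hAdj? : ∀ A u v x y → Dec (HAdj A u v x y)
  hAdj? A u v x y = sumAdj? A x y ⊎-dec (((x ≟ u) ×-dec (y ≟ v)) ⊎-dec ((x ≟ v) ×-dec (y ≟ u)))

  IsC4Seq : Subset n → Fin n → Fin n → Fin n → Fin n → Fin n → Fin n → Set
  IsC4Seq A u v a b c d =
    (a ≢ b × a ≢ c × a ≢ d × b ≢ c × b ≢ d × c ≢ d) ×
    (HAdj A u v a b × HAdj A u v b c × HAdj A u v c d × HAdj A u v d a)

  isC4Seq? : ∀ A u v a b c d → Dec (IsC4Seq A u v a b c d)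
  isC4Seq? A u v a b c d =
    (¬? (a ≟ b) ×-dec ¬? (a ≟ c) ×-dec ¬? (a ≟ d) ×-dec ¬? (b ≟ c) ×-dec ¬? (b ≟ d) ×-dec ¬? (c ≟ d))
    ×-dec (hAdj? A u v a b ×-dec hAdj? A u v b c ×-dec hAdj? A u v c d ×-dec hAdj? A u v d a)

  Σ[_] : (Fin n → ℕ) → ℕ
  Σ[ f ] = sum (map f (allFin n))

  c4Sequences : Subset n → Fin n → Fin n → ℕ
  c4Sequences A u v = Σ[ (λ a → Σ[ (λ b → Σ[ (λ c → Σ[ (λ d →
    if does (isC4Seq? A u v a b c d) then 1 else 0) ]) ]) ]) ]

  -- number of copies (subgraphs) of C4 in H: each copy corresponds to exactly
  -- 8 such sequences (4 starting points × 2 directions)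
  c4Copies : Subset n → Fin n → Fin n → ℕ
  c4Copies A u v = c4Sequences A u v / 8

module Submission where

-- Adding a non-edge {u,v} to the sum graph of a zero-deficiency Sidon set A
-- creates at least |A| - 2 ≥ √|X| - 2 copies of C4, all through the new edge.
--
-- Call x "good" if x is a neighbour of u but not of v in the sum graph.  For
-- good x, zero deficiency writes v - x = c - b with b, c ∈ A; then y = b - x has
-- x + y = b and y + v = c, so u x y v is a 4-cycle of H.  An ordered 4-cycle
-- has 8 rotations/reflections, placing the edge uv in 8 different "slots" of
-- the vertex sequence; a general lemma (EdgeSlots) shows that for any F
-- vanishing on tuples with a repeated entry the 8 slot sums are disjoint parts
-- of the total, hence 8 · #good ≤ c4Sequences, i.e. #good ≤ c4Copies.
-- The Sidon property leaves u and v at most one common neighbour, so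
-- |A| ≤ #good + 2, while A - A = X gives |X| ≤ |A|².  Elementary arithmetic then
-- yields k² |X| ≤ (k+1)² c4Copies² once |X| ≥ (2k+2)².

open import Defs
open import Data.Nat using (ℕ; zero; suc; _*_; _≤_; z≤n) renaming (_+_ to _+ℕ_)
open import Data.Nat.Properties
  using (+-*-semiring; +-commutativeSemigroup; +-identityʳ; +-assoc; +-mono-≤; +-monoʳ-≤; +-monoˡ-≤; +-cancelˡ-≤;
         *-mono-≤; *-monoʳ-≤; *-mono-<; *-comm; ≤-refl; ≤-trans; ≤-reflexive; m≤m+n; m≤n+m;
         ≮⇒≥; <-irrefl; <-≤-trans; module ≤-Reasoning)
open import Data.Nat.DivMod using (m*n/n≡m; /-monoˡ-≤)
open import Data.Nat.Solver using (module +-*-Solver)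
open import Data.Fin using (Fin; zero; suc; _≟_)
open import Data.Fin.Properties using (suc-injective)
open import Data.Fin.Permutation using (permutation)
open import Data.Fin.Subset using (Subset; _∈_; _∉_)
open import Data.Fin.Subset.Properties using (_∈?_)
open import Data.List using (map; allFin; tabulate)
open import Data.List.Properties using (map-tabulate)
import Data.Nat.ListAction as List
open import Data.Product using (∃; ∃-syntax; _×_; _,_; proj₁; proj₂)
open import Data.Sum using (_⊎_; inj₁; inj₂)
open import Data.Empty using (⊥-elim)
open import Data.Bool using (if_then_else_)
open import Relation.Nullary using (Dec; yes; no; ¬_; does)
open import Relation.Nullary.Decidable using (_×-dec_; ¬?)
open import Relation.Binary.PropositionalEquality
open import Algebra.Bundles using (AbelianGroup)
open import Algebra.Properties.Semiring.Sum +-*-semiring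
  using (sum; sum-cong-≗; sum-remove; sum-replicate-zero; sum-permute; *-distribˡ-sum)
import Algebra.Properties.Group as GroupProperties
import Algebra.Properties.CommutativeSemigroup as CommutativeSemigroupProperties

module FiniteSums where

  open import Data.Nat using (_+_)

  sum-allFin : ∀ {n} (f : Fin n → ℕ) → List.sum (map f (allFin n)) ≡ sum f
  sum-allFin {n} f = trans (cong List.sum (map-tabulate (λ x → x) f)) (sum-tabulate f)
    where
    sum-tabulate : ∀ {m} (g : Fin m → ℕ) → List.sum (tabulate g) ≡ sum g
    sum-tabulate {zero}  g = refl
    sum-tabulate {suc m} g = cong (g zero +_) (sum-tabulate (λ x → g (suc x)))

  sum-mono : ∀ {n} {f g : Fin n → ℕ} → (∀ x → f x ≤ g x) → sum f ≤ sum g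
  sum-mono {zero}  f≤g = z≤n
  sum-mono {suc n} f≤g = +-mono-≤ (f≤g zero) (sum-mono (λ x → f≤g (suc x)))

  sum-+ : ∀ {n} (f g : Fin n → ℕ) → sum (λ x → f x + g x) ≡ sum f + sum g
  sum-+ {zero}  f g = refl
  sum-+ {suc n} f g = begin
    (f zero + g zero) + sum (λ x → f (suc x) + g (suc x))
      ≡⟨ cong ((f zero + g zero) +_) (sum-+ (λ x → f (suc x)) (λ x → g (suc x))) ⟩
    (f zero + g zero) + (sum (λ x → f (suc x)) + sum (λ x → g (suc x)))
      ≡⟨ interchange (f zero) (g zero) _ _ ⟩
    (f zero + sum (λ x → f (suc x))) + (g zero + sum (λ x → g (suc x))) ∎
    where
    open ≡-Reasoning
    open CommutativeSemigroupProperties +-commutativeSemigroup using (interchange)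

  sum-swap : ∀ {m n} (h : Fin m → Fin n → ℕ) →
    sum (λ x → sum (λ y → h x y)) ≡ sum (λ y → sum (λ x → h x y))
  sum-swap {zero} {n} h = sym (sum-replicate-zero n)
  sum-swap {suc m} h = trans (cong (sum (h zero) +_) (sum-swap (λ x → h (suc x))))
                             (sym (sum-+ (h zero) (λ y → sum (λ x → h (suc x) y))))

  sum-vanish : ∀ {n} {f : Fin n → ℕ} → (∀ x → f x ≡ 0) → sum f ≡ 0
  sum-vanish {n} f≡0 = trans (sum-cong-≗ f≡0) (sum-replicate-zero n)

  sum-ones : ∀ n → sum {n} (λ _ → 1) ≡ n
  sum-ones zero    = refl
  sum-ones (suc n) = cong suc (sum-ones n)

  sum-point : ∀ {n} (f : Fin n → ℕ) (p : Fin n) → f p ≤ sum f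
  sum-point {suc n} f p = ≤-trans (m≤m+n (f p) _) (≤-reflexive (sym (sum-remove {i = p} f)))

  only : ∀ {n} → Fin n → (Fin n → ℕ) → Fin n → ℕ
  only p f x = if does (x ≟ p) then f x else 0

  sum-only : ∀ {n} (p : Fin n) (f : Fin n → ℕ) → sum (only p f) ≡ f p
  sum-only {suc n} zero    f = trans (cong (f zero +_) (sum-replicate-zero n)) (+-identityʳ (f zero))
  sum-only {suc n} (suc p) f = sum-only p (λ x → f (suc x))

  drop-zero : ∀ {x y z} → y ≡ 0 → x ≤ z → x + y ≤ z
  drop-zero {x} y≡0 x≤z = subst (_≤ _) (sym (trans (cong (x +_) y≡0) (+-identityʳ x))) x≤z

  split-one : ∀ {n} (q : Fin n) (f R U : Fin n → ℕ) →
    f q + R q ≤ U q → (∀ b → R b ≤ U b) → f q + sum R ≤ sum U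
  split-one q f R U at-q R≤U =
    subst (_≤ sum U) (trans (sum-+ (only q f) R) (cong (_+ sum R) (sum-only q f))) (sum-mono bound)
    where
    bound : ∀ b → only q f b + R b ≤ U b
    bound b with b ≟ q
    ... | yes refl = at-q
    ... | no _     = R≤U b

  split-two : ∀ {n} (p q : Fin n) → p ≢ q → (f g R U : Fin n → ℕ) →
    f p + R p ≤ U p → g q + R q ≤ U q → (∀ a → R a ≤ U a) → f p + g q + sum R ≤ sum U
  split-two p q p≢q f g R U at-p at-q R≤U = subst (_≤ sum U) total (sum-mono bound)
    where
    bound : ∀ a → only p f a + only q g a + R a ≤ U a
    bound a with a ≟ p | a ≟ q
    ... | yes refl | yes refl = ⊥-elim (p≢q refl)
    ... | yes refl | no _     = subst (λ t → t + R a ≤ U a) (sym (+-identityʳ (f a))) at-p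
    ... | no _     | yes refl = at-q
    ... | no _     | no _     = R≤U a
    total : sum (λ a → only p f a + only q g a + R a) ≡ f p + g q + sum R
    total = begin
      sum (λ a → only p f a + only q g a + R a)
        ≡⟨ sum-+ (λ a → only p f a + only q g a) R ⟩
      sum (λ a → only p f a + only q g a) + sum R
        ≡⟨ cong (_+ sum R) (sum-+ (only p f) (only q g)) ⟩
      sum (only p f) + sum (only q g) + sum R
        ≡⟨ cong₂ (λ s t → s + t + sum R) (sum-only p f) (sum-only q g) ⟩
      f p + g q + sum R ∎
      where open ≡-Reasoning

  sum-two : ∀ {n} (U : Fin n → ℕ) (p q : Fin n) → p ≢ q → U p + U q ≤ sum U
  sum-two {n} U p q p≢q = begin
    U p + U q                       ≡⟨ sym (+-identityʳ _) ⟩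
    U p + U q + 0                   ≡⟨ cong (U p + U q +_) (sym (sum-replicate-zero n)) ⟩
    U p + U q + sum {n} (λ _ → 0)   ≤⟨ split-two p q p≢q U U (λ _ → 0) U at-point at-point (λ _ → z≤n) ⟩
    sum U                           ∎
    where
    open ≤-Reasoning
    at-point : ∀ {a} → U a + 0 ≤ U a
    at-point = ≤-reflexive (+-identityʳ _)

  𝟙 : ∀ {P : Set} → Dec P → ℕ
  𝟙 d = if does d then 1 else 0

  𝟙-yes : ∀ {P : Set} (d : Dec P) → P → 𝟙 d ≡ 1
  𝟙-yes (yes _) _  = refl
  𝟙-yes (no ¬p) p = ⊥-elim (¬p p)

  𝟙-no : ∀ {P : Set} (d : Dec P) → ¬ P → 𝟙 d ≡ 0
  𝟙-no (yes p) ¬p = ⊥-elim (¬p p)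
  𝟙-no (no _)  _  = refl

  count : ∀ {n} {P : Fin n → Set} → (∀ x → Dec (P x)) → ℕ
  count d = sum (λ x → 𝟙 (d x))

  count-none : ∀ {n} {P : Fin n → Set} (d : ∀ x → Dec (P x)) → (∀ x → ¬ P x) → count d ≡ 0
  count-none d none = sum-vanish (λ x → 𝟙-no (d x) (none x))

  count-≤1 : ∀ {n} {P : Fin n → Set} (d : ∀ x → Dec (P x)) →
    (∀ {x y} → P x → P y → x ≡ y) → count d ≤ 1
  count-≤1 {zero}  d unique = z≤n
  count-≤1 {suc n} d unique with d zero
  ... | yes p₀ = ≤-reflexive (cong suc (count-none (λ x → d (suc x)) (λ x p → 0≢suc (unique p₀ p))))
    where
    0≢suc : ∀ {x : Fin n} → zero ≢ suc x
    0≢suc ()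
  ... | no _   = count-≤1 (λ x → d (suc x)) (λ p p′ → suc-injective (unique p p′))

  count-cover : ∀ {n} {P P₁ P₂ P₃ : Fin n → Set} (d : ∀ x → Dec (P x))
    (d₁ : ∀ x → Dec (P₁ x)) (d₂ : ∀ x → Dec (P₂ x)) (d₃ : ∀ x → Dec (P₃ x)) →
    (∀ x → P x → P₁ x ⊎ P₂ x ⊎ P₃ x) → count d ≤ count d₁ + count d₂ + count d₃
  count-cover d d₁ d₂ d₃ cover =
    subst (count d ≤_) total (sum-mono bound)
    where
    bound : ∀ x → 𝟙 (d x) ≤ 𝟙 (d₁ x) + 𝟙 (d₂ x) + 𝟙 (d₃ x)
    bound x with d x
    ... | no _  = z≤n
    ... | yes p with cover x p
    ... | inj₁ p₁        = ≤-trans (≤-reflexive (sym (𝟙-yes (d₁ x) p₁))) (≤-trans (m≤m+n _ _) (m≤m+n _ _))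
    ... | inj₂ (inj₁ p₂) = ≤-trans (≤-reflexive (sym (𝟙-yes (d₂ x) p₂))) (≤-trans (m≤n+m _ (𝟙 (d₁ x))) (m≤m+n _ _))
    ... | inj₂ (inj₂ p₃) = ≤-trans (≤-reflexive (sym (𝟙-yes (d₃ x) p₃))) (m≤n+m _ _)
    total : sum (λ x → 𝟙 (d₁ x) + 𝟙 (d₂ x) + 𝟙 (d₃ x)) ≡ count d₁ + count d₂ + count d₃
    total = trans (sum-+ (λ x → 𝟙 (d₁ x) + 𝟙 (d₂ x)) (λ x → 𝟙 (d₃ x)))
                  (cong (_+ count d₃) (sum-+ (λ x → 𝟙 (d₁ x)) (λ x → 𝟙 (d₂ x))))

  count-≤-rows : ∀ {m n} {P : Fin m → Set} (d : ∀ x → Dec (P x)) (h : Fin m → Fin n → ℕ) →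
    (∀ x → P x → ∃ λ y → 1 ≤ h x y) → count d ≤ sum (λ x → sum (h x))
  count-≤-rows d h witness = sum-mono bound
    where
    bound : ∀ x → 𝟙 (d x) ≤ sum (h x)
    bound x with d x
    ... | no _  = z≤n
    ... | yes p = ≤-trans (proj₂ (witness x p)) (sum-point (h x) (proj₁ (witness x p)))

open FiniteSums

Distinct : ∀ {n} → Fin n → Fin n → Fin n → Fin n → Set
Distinct a b c d = a ≢ b × a ≢ c × a ≢ d × b ≢ c × b ≢ d × c ≢ d

-- The tuples in which p and q are cyclically consecutive
-- fall into 8 disjoint classes (the position of p, and whether q follows or
-- precedes it); the sums of F over these classes add up to at most its total.
module EdgeSlots {n : ℕ} (F : Fin n → Fin n → Fin n → Fin n → ℕ)
  (vanish : ∀ {a b c d} → ¬ Distinct a b c d → F a b c d ≡ 0) where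

  open import Data.Nat using (_+_)

  total : ℕ
  total = sum λ a → sum λ b → sum λ c → sum λ d → F a b c d

  fromStart : Fin n → Fin n → ℕ
  fromStart p q = (sum λ c → sum λ d → F p q c d) + (sum λ b → sum λ c → F p b c q)

  notFromStart : Fin n → Fin n → ℕ
  notFromStart p q = (sum λ a → sum λ d → F a p q d) + (sum λ a → sum λ d → F a q p d)
                   + ((sum λ a → sum λ b → F a b q p) + (sum λ a → sum λ b → F a b p q))

  private
    startingAt : Fin n → ℕ
    startingAt a = sum λ b → sum λ c → sum λ d → F a b c d

    through : Fin n → Fin n → Fin n → ℕ
    through p q a = (sum λ d → F a p q d) + (sum λ d → F a q p d)
                  + ((sum λ b → F a b q p) + (sum λ b → F a b p q))

    sum-through : ∀ p q → sum (through p q) ≡ notFromStart p q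
    sum-through p q = begin
      sum (through p q)
        ≡⟨ sum-+ (λ a → (sum λ d → F a p q d) + (sum λ d → F a q p d))
                 (λ a → (sum λ b → F a b q p) + (sum λ b → F a b p q)) ⟩
      sum (λ a → (sum λ d → F a p q d) + (sum λ d → F a q p d))
        + sum (λ a → (sum λ b → F a b q p) + (sum λ b → F a b p q))
        ≡⟨ cong₂ _+_ (sum-+ (λ a → sum λ d → F a p q d) (λ a → sum λ d → F a q p d))
                     (sum-+ (λ a → sum λ b → F a b q p) (λ a → sum λ b → F a b p q)) ⟩
      notFromStart p q ∎
      where open ≡-Reasoning

  -- Inside the tuples starting with p, those with q second and those with q
  -- last are disjoint, since q cannot occupy both positions.
  fromStart≤ : ∀ p q → fromStart p q ≤ startingAt p
  fromStart≤ p q = split-one q U (λ b → sum λ c → F p b c q) U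
      (drop-zero (sum-vanish {n} λ c → vanish λ { (_ , _ , _ , _ , b≢d , _) → b≢d refl }) ≤-refl)
      (λ b → sum-mono λ c → sum-point (λ d → F p b c d) q)
    where
    U : Fin n → ℕ
    U b = sum λ c → sum λ d → F p b c d

  -- Inside the tuples starting with a, the four ways of placing p, q at
  -- positions 1,2 or 2,3 are disjoint since p ≢ q and entries are distinct.
  through≤ : ∀ p q → p ≢ q → ∀ a → through p q a ≤ startingAt a
  through≤ p q p≢q a = subst (_≤ startingAt a) (cong (f p + g q +_) (sum-+ (λ b → F a b q p) (λ b → F a b p q)))
      (split-two p q p≢q f g R V
        (drop-zero (R-vanishes (inj₁ refl)) (sum-point (λ c → sum λ d → F a p c d) q))
        (drop-zero (R-vanishes (inj₂ refl)) (sum-point (λ c → sum λ d → F a q c d) p))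
        R≤V)
    where
    V f g R : Fin n → ℕ
    V b = sum λ c → sum λ d → F a b c d
    f b = sum λ d → F a b q d
    g b = sum λ d → F a b p d
    R b = F a b q p + F a b p q
    R-vanishes : ∀ {b} → b ≡ p ⊎ b ≡ q → R b ≡ 0
    R-vanishes (inj₁ refl) = cong₂ _+_ (vanish λ { (_ , _ , _ , _ , b≢d , _) → b≢d refl })
                                       (vanish λ { (_ , _ , _ , b≢c , _ , _) → b≢c refl })
    R-vanishes (inj₂ refl) = cong₂ _+_ (vanish λ { (_ , _ , _ , b≢c , _ , _) → b≢c refl })
                                       (vanish λ { (_ , _ , _ , _ , b≢d , _) → b≢d refl })
    R≤V : ∀ b → R b ≤ V b
    R≤V b = ≤-trans (+-mono-≤ (sum-point _ p) (sum-point _ q))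
                    (sum-two (λ c → sum λ d → F a b c d) q p (≢-sym p≢q))

  -- The eight slot sums are disjoint parts of the total: split the tuples by
  -- their first entry (p, q, or neither).
  edge-slots : ∀ p q → p ≢ q → fromStart p q + fromStart q p + notFromStart p q ≤ total
  edge-slots p q p≢q =
    ≤-trans (+-mono-≤ (+-mono-≤ (fromStart≤ p q) (fromStart≤ q p)) (≤-reflexive (sym (sum-through p q))))
      (split-two p q p≢q startingAt startingAt (through p q) startingAt
        (drop-zero through-p ≤-refl) (drop-zero through-q ≤-refl) (through≤ p q p≢q))
    where
    through-p : through p q p ≡ 0
    through-p = cong₂ _+_
      (cong₂ _+_ (sum-vanish {n} λ d → vanish λ { (a≢b , _) → a≢b refl })
                 (sum-vanish {n} λ d → vanish λ { (_ , a≢c , _) → a≢c refl }))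
      (cong₂ _+_ (sum-vanish {n} λ b → vanish λ { (_ , _ , a≢d , _) → a≢d refl })
                 (sum-vanish {n} λ b → vanish λ { (_ , a≢c , _) → a≢c refl }))
    through-q : through p q q ≡ 0
    through-q = cong₂ _+_
      (cong₂ _+_ (sum-vanish {n} λ d → vanish λ { (_ , a≢c , _) → a≢c refl })
                 (sum-vanish {n} λ d → vanish λ { (a≢b , _) → a≢b refl }))
      (cong₂ _+_ (sum-vanish {n} λ b → vanish λ { (_ , a≢c , _) → a≢c refl })
                 (sum-vanish {n} λ b → vanish λ { (_ , _ , a≢d , _) → a≢d refl }))


module GroupFacts (G : FinAbGroup) where
  open FinAbGroup G

  infixl 6 _-_
  _-_ : Fin n → Fin n → Fin n
  x - y = x + (- y)

  abelianGroup : AbelianGroup _ _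
  abelianGroup = record { isAbelianGroup = isAbelianGroup }

  open AbelianGroup abelianGroup public using (comm; assoc)
  open GroupProperties (AbelianGroup.group abelianGroup) public
    using (∙-cancelˡ; ∙-cancelʳ; //-rightDividesˡ; //-rightDividesʳ)
  open CommutativeSemigroupProperties (AbelianGroup.commutativeSemigroup abelianGroup) public
    using (interchange)

  sum-translate : ∀ (f : Fin n → ℕ) b → sum (λ x → f (x + b)) ≡ sum f
  sum-translate f b = sym (sum-permute f (permutation (_+ b) (_- b)
    (λ y → //-rightDividesˡ b y) (λ y → //-rightDividesʳ b y)))

  size : Subset n → ℕ
  size A = count (_∈? A)

  -- |X| ≤ |A|² when A - A = X: every x is a difference, so some b ∈ A has x + b ∈ A.
  order≤size² : ∀ A → ZeroDeficiency G A → n ≤ size A * size A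
  order≤size² A full = begin
    n
      ≡⟨ sym (sum-ones n) ⟩
    sum {n} (λ x → 1)
      ≤⟨ sum-mono representation ⟩
    sum (λ x → sum (λ b → 𝟙 (b ∈? A) * 𝟙 ((x + b) ∈? A)))
      ≡⟨ sum-swap (λ x b → 𝟙 (b ∈? A) * 𝟙 ((x + b) ∈? A)) ⟩
    sum (λ b → sum (λ x → 𝟙 (b ∈? A) * 𝟙 ((x + b) ∈? A)))
      ≡⟨ sum-cong-≗ (λ b → sym (*-distribˡ-sum (𝟙 (b ∈? A)) (λ x → 𝟙 ((x + b) ∈? A)))) ⟩
    sum (λ b → 𝟙 (b ∈? A) * sum (λ x → 𝟙 ((x + b) ∈? A)))
      ≡⟨ sum-cong-≗ (λ b → cong (𝟙 (b ∈? A) *_) (sum-translate (λ z → 𝟙 (z ∈? A)) b)) ⟩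
    sum (λ b → 𝟙 (b ∈? A) * size A)
      ≡⟨ sum-cong-≗ (λ b → *-comm (𝟙 (b ∈? A)) (size A)) ⟩
    sum (λ b → size A * 𝟙 (b ∈? A))
      ≡⟨ sym (*-distribˡ-sum (size A) (λ b → 𝟙 (b ∈? A))) ⟩
    size A * size A ∎
    where
    open ≤-Reasoning
    representation : ∀ x → 1 ≤ sum (λ b → 𝟙 (b ∈? A) * 𝟙 ((x + b) ∈? A))
    representation x with full x
    ... | a , b , a∈A , b∈A , x≡a-b =
      ≤-trans (≤-reflexive (sym (cong₂ _*_ (𝟙-yes (b ∈? A) b∈A) (𝟙-yes ((x + b) ∈? A) x+b∈A))))
              (sum-point _ b)
      where
      x+b∈A : (x + b) ∈ A
      x+b∈A = subst (_∈ A) (sym (trans (cong (_+ b) x≡a-b) (//-rightDividesˡ b a))) a∈A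

module AddedEdge (G : FinAbGroup) (A : Subset (FinAbGroup.n G))
  (sidon : IsSidon G A) (full : ZeroDeficiency G A)
  (u v : Fin (FinAbGroup.n G)) (u≢v : u ≢ v) (uv∉G : ¬ SumAdj G A u v) where

  open FinAbGroup G
  open GroupFacts G

  private
    ∈-comm : ∀ {x y} → (x + y) ∈ A → (y + x) ∈ A
    ∈-comm {x} {y} = subst (_∈ A) (comm x y)

  C4 : Fin n → Fin n → Fin n → Fin n → Set
  C4 = IsC4Seq G A u v

  H-sym : ∀ {x y} → HAdj G A u v x y → HAdj G A u v y x
  H-sym (inj₁ (x≢y , x+y∈A))        = inj₁ (≢-sym x≢y , ∈-comm x+y∈A)
  H-sym (inj₂ (inj₁ (x≡u , y≡v))) = inj₂ (inj₂ (y≡v , x≡u))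
  H-sym (inj₂ (inj₂ (x≡v , y≡u))) = inj₂ (inj₁ (y≡u , x≡v))

  rotate : ∀ {a b c d} → C4 a b c d → C4 b c d a
  rotate ((a≢b , a≢c , a≢d , b≢c , b≢d , c≢d) , (ab , bc , cd , da)) =
    (b≢c , b≢d , ≢-sym a≢b , c≢d , ≢-sym a≢c , ≢-sym a≢d) , (bc , cd , da , ab)

  reverse : ∀ {a b c d} → C4 a b c d → C4 d c b a
  reverse ((a≢b , a≢c , a≢d , b≢c , b≢d , c≢d) , (ab , bc , cd , da)) =
    (≢-sym c≢d , ≢-sym b≢d , ≢-sym a≢d , ≢-sym b≢c , ≢-sym a≢c , ≢-sym a≢b) ,
    (H-sym cd , H-sym bc , H-sym ab , H-sym da)

  Good : Fin n → Set
  Good x = (x + u) ∈ A × x ≢ u × (x + v) ∉ A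

  good? : ∀ x → Dec (Good x)
  good? x = ((x + u) ∈? A) ×-dec ¬? (x ≟ u) ×-dec ¬? ((x + v) ∈? A)

  -- Every good x lies on a 4-cycle u x y v through the new edge: writing
  -- v - x = c - b with b, c ∈ A, the vertex y = b - x has x + y = b, y + v = c.
  good-cycle : ∀ {x} → Good x → ∃ λ y → C4 u x y v
  good-cycle {x} (x+u∈A , x≢u , x+v∉A) with full (v - x)
  ... | c , b , c∈A , b∈A , v-x≡c-b =
    b - x , (≢-sym x≢u , u≢y , u≢v , x≢y , x≢v , y≢v) ,
            (inj₁ (≢-sym x≢u , ∈-comm x+u∈A) , inj₁ (x≢y , x+y∈A) , inj₁ (y≢v , y+v∈A) ,
             inj₂ (inj₂ (refl , refl)))
    where
    y : Fin n
    y = b - x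
    x+y∈A : (x + y) ∈ A
    x+y∈A = subst (_∈ A) (sym (trans (comm x y) (//-rightDividesˡ x b))) b∈A
    y+v≡c : y + v ≡ c
    y+v≡c = begin
      (b + (- x)) + v ≡⟨ assoc b (- x) v ⟩
      b + ((- x) + v) ≡⟨ cong (b +_) (trans (comm (- x) v) v-x≡c-b) ⟩
      b + (c - b)     ≡⟨ comm b (c - b) ⟩
      (c - b) + b     ≡⟨ //-rightDividesˡ b c ⟩
      c               ∎
      where open ≡-Reasoning
    y+v∈A : (y + v) ∈ A
    y+v∈A = subst (_∈ A) (sym y+v≡c) c∈A
    u≢y : u ≢ y
    u≢y u≡y = uv∉G (u≢v , subst (λ z → (z + v) ∈ A) (sym u≡y) y+v∈A)
    x≢y : x ≢ y
    x≢y x≡y = x+v∉A (subst (λ z → (z + v) ∈ A) (sym x≡y) y+v∈A)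
    x≢v : x ≢ v
    x≢v x≡v = uv∉G (u≢v , ∈-comm (subst (λ z → (z + u) ∈ A) x≡v x+u∈A))
    y≢v : y ≢ v
    y≢v y≡v = x+v∉A (subst (λ z → (x + z) ∈ A) y≡v x+y∈A)

  -- A Sidon set gives two distinct vertices at most one common neighbour
  -- (here: x with x + u, x + v ∈ A), since (x+u)+(y+v) = (y+u)+(x+v).
  CommonNeighbour : Fin n → Set
  CommonNeighbour x = (x + u) ∈ A × (x + v) ∈ A

  common-neighbour-unique : ∀ {x y} → CommonNeighbour x → CommonNeighbour y → x ≡ y
  common-neighbour-unique {x} {y} (x+u∈A , x+v∈A) (y+u∈A , y+v∈A)
    with sidon x+u∈A y+v∈A y+u∈A x+v∈A exchange
    where
    exchange : (x + u) + (y + v) ≡ (y + u) + (x + v)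
    exchange = begin
      (x + u) + (y + v)   ≡⟨ interchange x u y v ⟩
      (x + y) + (u + v)   ≡⟨ cong (_+ (u + v)) (comm x y) ⟩
      (y + x) + (u + v)   ≡⟨ interchange y x u v ⟩
      (y + u) + (x + v)   ∎
      where open ≡-Reasoning
  ... | inj₁ (x+u≡y+u , _) = ∙-cancelʳ u x y x+u≡y+u
  ... | inj₂ (x+u≡x+v , _) = ⊥-elim (u≢v (∙-cancelˡ x u v x+u≡x+v))

  #good : ℕ
  #good = count good?

  -- Apart from u itself and the (at most one) common neighbour, every
  -- neighbour of u is good; so |A| ≤ #good + 2.
  size≤#good+2 : size A ≤ #good +ℕ 2
  size≤#good+2 = begin
    size A
      ≡⟨ sym (sum-translate (λ z → 𝟙 (z ∈? A)) u) ⟩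
    count (λ x → (x + u) ∈? A)
      ≤⟨ count-cover (λ x → (x + u) ∈? A) good? (_≟ u) common? cover ⟩
    #good +ℕ count (_≟ u) +ℕ count common?
      ≤⟨ +-mono-≤ (+-monoʳ-≤ #good (count-≤1 (_≟ u) (λ x≡u y≡u → trans x≡u (sym y≡u))))
                  (count-≤1 common? common-neighbour-unique) ⟩
    #good +ℕ 1 +ℕ 1
      ≡⟨ +-assoc #good 1 1 ⟩
    #good +ℕ 2 ∎
    where
    open ≤-Reasoning
    common? : ∀ x → Dec (CommonNeighbour x)
    common? x = ((x + u) ∈? A) ×-dec ((x + v) ∈? A)
    cover : ∀ x → (x + u) ∈ A → Good x ⊎ x ≡ u ⊎ CommonNeighbour x
    cover x x+u∈A with x ≟ u | (x + v) ∈? A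
    ... | yes x≡u | _         = inj₂ (inj₁ x≡u)
    ... | no _    | yes x+v∈A = inj₂ (inj₂ (x+u∈A , x+v∈A))
    ... | no x≢u  | no x+v∉A  = inj₁ (x+u∈A , x≢u , x+v∉A)

  cycle : Fin n → Fin n → Fin n → Fin n → ℕ
  cycle a b c d = 𝟙 (isC4Seq? G A u v a b c d)

  counted : ∀ {a b c d} → C4 a b c d → 1 ≤ cycle a b c d
  counted {a} {b} {c} {d} isC4 = ≤-reflexive (sym (𝟙-yes (isC4Seq? G A u v a b c d) isC4))

  open EdgeSlots cycle (λ {a} {b} {c} {d} ¬distinct →
    𝟙-no (isC4Seq? G A u v a b c d) (λ isC4 → ¬distinct (proj₁ isC4)))

  c4Sequences≡total : c4Sequences G A u v ≡ total
  c4Sequences≡total =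
    trans (sum-allFin (λ a → Σ[_] G λ b → Σ[_] G λ c → Σ[_] G λ d → cycle a b c d)) (sum-cong-≗ λ a →
    trans (sum-allFin (λ b → Σ[_] G λ c → Σ[_] G λ d → cycle a b c d)) (sum-cong-≗ λ b →
    trans (sum-allFin (λ c → Σ[_] G λ d → cycle a b c d)) (sum-cong-≗ λ c → sum-allFin (cycle a b c))))

  -- Each placement of the cycles u x y v (x good) into tuples is injective in
  -- (x, y), so it contributes at least #good to the corresponding slot sum.
  good≤ : (h : Fin n → Fin n → ℕ) → (∀ {x y} → C4 u x y v → 1 ≤ h x y) →
    #good ≤ sum (λ x → sum (h x))
  good≤ h placed = count-≤-rows good? h (λ x good → let (y , isC4) = good-cycle good in y , placed isC4)

  good≤′ : (h : Fin n → Fin n → ℕ) → (∀ {x y} → C4 u x y v → 1 ≤ h x y) →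
    #good ≤ sum (λ y → sum (λ x → h x y))
  good≤′ h placed = subst (#good ≤_) (sum-swap h) (good≤ h placed)

  -- The 8 dihedral images of u x y v fill the 8 slots of the edge uv: each of
  -- the eight bounds below places the cycle by one rotation/reflection.
  8#good≤sequences : 8 * #good ≤ c4Sequences G A u v
  8#good≤sequences = begin
    8 * #good
      ≡⟨ eight #good ⟩
    (#good +ℕ #good) +ℕ (#good +ℕ #good) +ℕ ((#good +ℕ #good) +ℕ (#good +ℕ #good))
      ≤⟨ +-mono-≤
           (+-mono-≤
             (+-mono-≤ (good≤′ (λ x y → cycle u v y x) (λ c → counted (rotate (rotate (rotate (reverse c))))))
                       (good≤ (λ x y → cycle u x y v) counted))
             (+-mono-≤ (good≤ (λ x y → cycle v u x y) (λ c → counted (rotate (rotate (rotate c)))))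
                       (good≤′ (λ x y → cycle v y x u) (λ c → counted (reverse c)))))
           (+-mono-≤
             (+-mono-≤ (good≤ (λ x y → cycle x u v y) (λ c → counted (rotate (rotate (reverse c)))))
                      (good≤′ (λ x y → cycle y v u x) (λ c → counted (rotate (rotate c)))))
             (+-mono-≤ (good≤ (λ x y → cycle x y v u) (λ c → counted (rotate c)))
                      (good≤′ (λ x y → cycle y x u v) (λ c → counted (rotate (reverse c)))))) ⟩
    fromStart u v +ℕ fromStart v u +ℕ notFromStart u v
      ≤⟨ edge-slots u v u≢v ⟩
    total
      ≡⟨ sym c4Sequences≡total ⟩
    c4Sequences G A u v ∎
    where
    open ≤-Reasoning
    eight : ∀ g → 8 * g ≡ (g +ℕ g) +ℕ (g +ℕ g) +ℕ ((g +ℕ g) +ℕ (g +ℕ g))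
    eight = +-*-Solver.solve 1 (λ g → con 8 :* g := (g :+ g) :+ (g :+ g) :+ ((g :+ g) :+ (g :+ g))) refl
      where open +-*-Solver

  #good≤copies : #good ≤ c4Copies G A u v
  #good≤copies = subst (_≤ c4Copies G A u v) (m*n/n≡m #good 8)
    (/-monoˡ-≤ 8 (subst (_≤ c4Sequences G A u v) (*-comm 8 #good) 8#good≤sequences))

square-reflects-≤ : ∀ {m n} → m * m ≤ n * n → m ≤ n
square-reflects-≤ m²≤n² = ≮⇒≥ λ n<m → <-irrefl refl (<-≤-trans (*-mono-< n<m n<m) m²≤n²)

-- If (2k+2)² ≤ n ≤ M² and M ≤ c + 2, then c ≥ M - 2 ≥ (k/(k+1)) √n, i.e.
-- k² n ≤ (k+1)² c².  The key step is k M ≤ (k+1) c, which holds as 2(k+1) ≤ M.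
root-bound : ∀ k {n M c} → (suc k +ℕ suc k) * (suc k +ℕ suc k) ≤ n → n ≤ M * M → M ≤ c +ℕ 2 →
  k * k * n ≤ suc k * suc k * (c * c)
root-bound k {n} {M} {c} n-large n≤M² M≤c+2 = begin
  k * k * n                   ≤⟨ *-monoʳ-≤ (k * k) n≤M² ⟩
  k * k * (M * M)             ≡⟨ solve 2 (λ k M → k :* k :* (M :* M) := (k :* M) :* (k :* M)) refl k M ⟩
  (k * M) * (k * M)           ≤⟨ *-mono-≤ kM≤[k+1]c kM≤[k+1]c ⟩
  (suc k * c) * (suc k * c)   ≡⟨ solve 2 (λ k c → (k :* c) :* (k :* c) := k :* k :* (c :* c)) refl (suc k) c ⟩
  suc k * suc k * (c * c)     ∎
  where
  open ≤-Reasoning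
  open +-*-Solver
  2[k+1]≤M : suc k +ℕ suc k ≤ M
  2[k+1]≤M = square-reflects-≤ (≤-trans n-large n≤M²)
  kM≤[k+1]c : k * M ≤ suc k * c
  kM≤[k+1]c = +-cancelˡ-≤ M (k * M) (suc k * c) (begin
    M +ℕ k * M                  ≡⟨⟩
    suc k * M                   ≤⟨ *-monoʳ-≤ (suc k) M≤c+2 ⟩
    suc k * (c +ℕ 2)            ≡⟨ solve 2 (λ k c → k :* (c :+ con 2) := (k :+ k) :+ k :* c) refl (suc k) c ⟩
    (suc k +ℕ suc k) +ℕ suc k * c ≤⟨ +-monoˡ-≤ (suc k * c) 2[k+1]≤M ⟩
    M +ℕ suc k * c              ∎)

-- For every k, once |X| ≥ (2k+2)², H has at least (k/(k+1)) √|X| copies of C4.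
mainTheorem1 : (k : ℕ) → ∃[ N ] ((G : FinAbGroup) → (A : Subset (FinAbGroup.n G)) →
    IsSidon G A → ZeroDeficiency G A →
    (u v : Fin (FinAbGroup.n G)) → u ≢ v → ¬ SumAdj G A u v →
    N ≤ FinAbGroup.n G →
    k * k * FinAbGroup.n G ≤ suc k * suc k * (c4Copies G A u v * c4Copies G A u v))
mainTheorem1 k = (suc k +ℕ suc k) * (suc k +ℕ suc k) , λ G A sidon full u v u≢v uv∉G n-large →
  let open AddedEdge G A sidon full u v u≢v uv∉G in
  root-bound k n-large (GroupFacts.order≤size² G A full)
    (≤-trans size≤#good+2 (+-monoˡ-≤ 2 #good≤copies))
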